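{- Let $c\ge 2$, $d\ge 3$, $H=K_d$, and let $k \geq 1$ be an integer. Then there exists a gadget $G$ with $k\cdot|H|$ portal vertices that strictly $(c,H)$-realizes the relation $\{(c-1,c-1,\dots,c-1)\}\subseteq\{0,\dots,c\}^{k|H|}$. Moreover, the size of $G$ is bounded by some function of $k$.
   Context: $K_d$ is the complete graph on $d$ vertices and $|H|=d$. A gadget is a graph $G$ with designated portal vertices $p_1,\dots,p_\ell$; the others are internal. A copy of $H$ is a subgraph isomorphic to $H$. A distinct (resp. multi) $(c,H)$-packing is a set (resp. multiset) of copies of $H$ covering each vertex at most $c$ times (with multiplicity). $G$ distinctly (resp. arbitrarily) $(c,H)$-realizes $R\subseteq\{0,\dots,c\}^\ell$ if $r\in R$ iff some distinct (resp. multi) $(c,H)$-packing of $G$ covers each internal vertex exactly $c$ times and each $p_i$ exactly $r_i$ times; $G$ strictly $(c,H)$-realizes $R$ if it does both. -}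

module Defs where

open import Data.Nat using (ℕ; zero; suc; _+_; _≤_)
open import Data.Bool using (Bool; true; false; if_then_else_)
open import Data.Fin using (Fin)
open import Data.Fin.Subset using (Subset; _∈_; ∣_∣)
open import Data.Vec using (lookup)
open import Data.List using (List; []; _∷_)
open import Data.List.Relation.Unary.All using (All)
open import Data.List.Relation.Unary.Unique.Propositional using (Unique)
open import Data.Product using (Σ; ∃; _×_; _,_)
open import Function.Definitions using (Injective)
open import Relation.Binary.PropositionalEquality using (_≡_; _≢_)
open import Relation.Nullary using (¬_)

record Graph : Set where
  field
    n      : ℕ
    adj    : Fin n → Fin n → Bool
    sym    : ∀ i j → adj i j ≡ adj j i
    irrefl : ∀ i → adj i i ≡ false
open Graph public

record Gadget (ℓ : ℕ) : Set where
  field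
    graph    : Graph
    portal   : Fin ℓ → Fin (n graph)
    portalInj : Injective _≡_ _≡_ portal
open Gadget public

size : ∀ {ℓ} → Gadget ℓ → ℕ
size G = n (graph G)

Internal : ∀ {ℓ} (G : Gadget ℓ) → Fin (n (graph G)) → Set
Internal {ℓ} G v = ¬ (Σ (Fin ℓ) λ i → portal G i ≡ v)

-- A copy of K_d in a graph Γ: a subgraph isomorphic to K_d, which is
-- determined by its vertex set: d vertices, pairwise adjacent.
IsCopyK : ℕ → (Γ : Graph) → Subset (n Γ) → Set
IsCopyK d Γ s = (∣ s ∣ ≡ d) ×
  (∀ i j → i ∈ s → j ∈ s → i ≢ j → adj Γ i j ≡ true)

cover : ∀ {m} → Fin m → List (Subset m) → ℕ
cover v [] = 0
cover v (s ∷ P) = (if lookup s v then 1 else 0) + cover v P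

-- Multi (c, K_d)-packing of Γ: multiset (list) of copies, each vertex covered ≤ c times.
IsMultiPacking : ℕ → ℕ → (Γ : Graph) → List (Subset (n Γ)) → Set
IsMultiPacking c d Γ P = All (IsCopyK d Γ) P × (∀ v → cover v P ≤ c)

IsDistinctPacking : ℕ → ℕ → (Γ : Graph) → List (Subset (n Γ)) → Set
IsDistinctPacking c d Γ P = IsMultiPacking c d Γ P × Unique P

CoversAs : ∀ {ℓ} (c : ℕ) (G : Gadget ℓ) → (Fin ℓ → ℕ) → List (Subset (n (graph G))) → Set
CoversAs c G r P = (∀ v → Internal G v → cover v P ≡ c) × (∀ i → cover (portal G i) P ≡ r i)

Relation : ℕ → ℕ → Set₁
Relation c ℓ = (Fin ℓ → Fin (suc c)) → Set

toℕs : ∀ {c ℓ} → (Fin ℓ → Fin (suc c)) → Fin ℓ → ℕ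
toℕs r i = Data.Fin.toℕ (r i)

record _⇔_ (A B : Set) : Set where
  field
    to   : A → B
    from : B → A

DistinctlyRealizes : ∀ {ℓ} (c d : ℕ) → Gadget ℓ → Relation c ℓ → Set
DistinctlyRealizes c d G R = ∀ r → R r ⇔
  (∃ λ P → IsDistinctPacking c d (graph G) P × CoversAs c G (toℕs r) P)

ArbitrarilyRealizes : ∀ {ℓ} (c d : ℕ) → Gadget ℓ → Relation c ℓ → Set
ArbitrarilyRealizes c d G R = ∀ r → R r ⇔
  (∃ λ P → IsMultiPacking c d (graph G) P × CoversAs c G (toℕs r) P)

StrictlyRealizes : ∀ {ℓ} (c d : ℕ) → Gadget ℓ → Relation c ℓ → Set
StrictlyRealizes c d G R = DistinctlyRealizes c d G R × ArbitrarilyRealizes c d G R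

Constant : ∀ {c ℓ} → ℕ → Relation c ℓ
Constant a r = ∀ i → Data.Fin.toℕ (r i) ≡ a

module Submission where

-- Each pair (g, t) of a group g < k and a slot t < d carries a core whose vertices are sorted
-- into d layers: a path
--   y₀ 0 – x₀ 0 – y₁ 0 – x₁ 0 – y₀ 1 – x₀ 1 – y₁ 1 – … – x₁ (c-2) – y₀ (c-1) – x₀ (c-1) – y₁ (c-1)
-- with every x in layer 0 and every y in layer 1, and apex cliques of size d - 2 filling layers
-- 2, …, d - 1, each completing some path edges to copies of K_d: the hub over every edge y₀ i x₀ i,
-- wing j over every edge x₀ i y₁ i, and bridge j over y₁ j x₁ j and over every edge x₁ i y₀ (i+1).
-- The portal of (g, t) is the end y₁ (c-1).
--
-- A copy of K_d through a core vertex meets each layer once, so it uses exactly one path edge.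
-- If every internal vertex is covered exactly c times, the multiplicities of consecutive path edges
-- sum to c and hence alternate a, c - a, …; the hub lies on the c edges y₀ i x₀ i, all of
-- multiplicity a, so a = 1, and the last edge, the only one at the portal, is used c - 1 times.
--
-- Conversely, taking every core copy once realises these multiplicities, except that the path end
-- y₀ 0 is covered only once. The fill vertices of a group, c per slot with y₀ 0 the one of colour 0,
-- form a clique; its copies of colour a in slot 1 and colour b in all other slots, for all
-- (a, b) ≠ (0, 0), cover colour 0 exactly c - 1 times and every other colour c times.

open import Data.Bool.Base using (Bool; true; false; _∧_; _∨_; not; if_then_else_)
open import Data.Bool.Properties using (∧-comm; ∨-comm; ∨-identityʳ; ∧-identityʳ)
open import Data.Empty using (⊥; ⊥-elim)
open import Data.Fin.Patterns using (0F; 1F; 2F)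
open import Data.Fin.Base using (Fin; zero; suc; inject₁; fromℕ; _↑ˡ_; _↑ʳ_; splitAt; combine; remQuot)
import Data.Fin.Properties as Finₚ
open import Data.Fin.Relation.Unary.Top using (view; ‵fromℕ; ‵inject₁)
open import Data.Fin.Subset using (Subset; _∈_; ∣_∣; _-_; inside; outside) renaming (⊤ to full)
open import Data.Fin.Subset.Properties using (∈⊤; x∈p∧x≢y⇒x∈p-y; x∈p⇒∣p-x∣<∣p∣; ∣⊤∣≡n; _∈?_)
open import Data.List.Base as List using (List; []; _∷_)
import Data.List.Relation.Unary.All.Properties as Allₚ
open import Data.List.Relation.Unary.Unique.Propositional using (Unique)
import Data.List.Relation.Unary.Unique.Propositional.Properties as Uniqueₚ
open import Data.List.Relation.Unary.All using (All; []; _∷_)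
open import Data.Nat.Base using (ℕ; zero; suc; _+_; _*_; _∸_; _≤_; z≤n; s≤s)
open import Data.Nat.Properties
open import Data.Product using (Σ; ∃; ∃!; _×_; _,_; proj₁; proj₂; uncurry)
open import Data.Product.Properties using (,-injective)
open import Data.Sum.Base using (_⊎_; inj₁; inj₂; [_,_]′)
import Data.Sum.Properties as Sumₚ
open import Data.Unit.Base using (⊤; tt)
open import Data.Vec.Base using ([]; _∷_; lookup; tabulate; here; there)
open import Data.Vec.Properties using (lookup∘tabulate; []=⇒lookup; lookup⇒[]=)
open import Function.Base using (_∘_)
open import Relation.Binary.Definitions using (DecidableEquality)
open import Relation.Binary.PropositionalEquality
open import Relation.Nullary using (¬_; yes; no; does)
open import Relation.Nullary.Decidable using (dec-true; dec-false; does-⇔; map′; _×-dec_)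
open import Function.Bundles using (mk⇔)

open import Defs using (Graph; adj; Gadget; portal; Internal; IsCopyK; cover; IsMultiPacking; CoversAs; toℕs;
  size; StrictlyRealizes; Constant) renaming (n to order)

open import Algebra.Properties.CommutativeMonoid.Sum +-0-commutativeMonoid
  using (sum; sum-syntax; sum-cong-≗; ∑-distrib-+; sum-replicate-zero)

true≢false : true ≢ false
true≢false ()

∧-true⁻ : ∀ {a b} → a ∧ b ≡ true → a ≡ true × b ≡ true
∧-true⁻ {true} b≡true = refl , b≡true

∨-trueˡ : ∀ {a} b → a ≡ true → a ∨ b ≡ true
∨-trueˡ b refl = refl

∨-trueʳ : ∀ a {b} → b ≡ true → a ∨ b ≡ true
∨-trueʳ true _ = refl
∨-trueʳ false b≡true = b≡true

∨-false⁻ : ∀ {a} → a ∨ false ≡ true → a ≡ true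
∨-false⁻ {a} a∨false = trans (sym (∨-identityʳ a)) a∨false

∨-true⁻ : ∀ {a b} → a ∨ b ≡ true → a ≡ true ⊎ b ≡ true
∨-true⁻ {true} _ = inj₁ refl
∨-true⁻ {false} b≡true = inj₂ b≡true

∧-transfer : ∀ {a b c} → (a ≡ true → b ≡ true → c ≡ true) → (b ≡ true → c ≡ true → a ≡ true) →
  a ∧ b ≡ b ∧ c
∧-transfer {true}  {true}  {true}  _ _ = refl
∧-transfer {true}  {true}  {false} ab⇒c _ = sym (ab⇒c refl refl)
∧-transfer {true}  {false} _ _ = refl
∧-transfer {false} {true}  {true}  _ bc⇒a = bc⇒a refl refl
∧-transfer {false} {true}  {false} _ _ = refl
∧-transfer {false} {false} _ _ = refl

module BoolEq {A : Set} (_≟_ : DecidableEquality A) where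

  infix 4 _==_
  _==_ : A → A → Bool
  x == y = does (x ≟ y)

  ==-refl : ∀ x → (x == x) ≡ true
  ==-refl x = dec-true (x ≟ x) refl

  ==-≢ : ∀ {x y} → x ≢ y → (x == y) ≡ false
  ==-≢ {x} {y} = dec-false (x ≟ y)

  ==⇒≡ : ∀ {x y} → (x == y) ≡ true → x ≡ y
  ==⇒≡ {x} {y} x==y with x ≟ y
  ... | yes x≡y = x≡y

  ==-sym : ∀ x y → (x == y) ≡ (y == x)
  ==-sym x y = does-⇔ (mk⇔ sym sym) (x ≟ y) (y ≟ x)

module FinEq {n : ℕ} = BoolEq (Finₚ._≟_ {n})
open FinEq public

-- ι b is the summand of cover, so covers unfold to sums of ι.
ι : Bool → ℕ
ι b = if b then 1 else 0

sum-zero : ∀ {m} {f : Fin m → ℕ} → (∀ i → f i ≡ 0) → sum f ≡ 0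
sum-zero {m} f≡0 = trans (sum-cong-≗ f≡0) (sum-replicate-zero m)

sum-const : ∀ m x → sum {m} (λ _ → x) ≡ m * x
sum-const zero x = refl
sum-const (suc m) x = cong (x +_) (sum-const m x)

sum-single : ∀ {m} (f : Fin m → ℕ) i₀ → (∀ i → i ≢ i₀ → f i ≡ 0) → sum f ≡ f i₀
sum-single f zero f≡0 = trans (cong (f zero +_) (sum-zero (λ i → f≡0 (suc i) (λ ())))) (+-identityʳ (f zero))
sum-single f (suc i₀) f≡0 = trans (cong (_+ sum (f ∘ suc)) (f≡0 zero (λ ())))
  (sum-single (f ∘ suc) i₀ (λ i i≢i₀ → f≡0 (suc i) (i≢i₀ ∘ Finₚ.suc-injective)))

sum-zero² : ∀ m p → ∑[ i < m ] ∑[ j < p ] 0 ≡ 0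
sum-zero² m p = sum-zero {m} (λ _ → sum-replicate-zero p)

sum-ones : ∀ m → ∑[ i < m ] 1 ≡ m
sum-ones m = trans (sum-const m 1) (*-identityʳ m)

sum-pick : ∀ {m} (i₀ : Fin m) (F : Bool → Fin m → ℕ) → (∀ i → F false i ≡ 0) →
  ∑[ i < m ] F (i₀ == i) i ≡ F true i₀
sum-pick i₀ F F-false = trans
  (sum-single _ i₀ (λ i i≢i₀ → trans (cong (λ b → F b i) (==-≢ (i≢i₀ ∘ sym))) (F-false i)))
  (cong (λ b → F b i₀) (==-refl i₀))

sum-indicator : ∀ {m} (i₀ : Fin m) → ∑[ i < m ] ι (i₀ == i) ≡ 1
sum-indicator i₀ = sum-pick i₀ (λ b _ → ι b) (λ _ → refl)

sum-indicator-outer : ∀ {m} (i₀ : Fin m) p → ∑[ i < m ] ∑[ j < p ] ι (i₀ == i) ≡ p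
sum-indicator-outer i₀ p = trans (sum-pick i₀ (λ b _ → ∑[ j < p ] ι b) (λ _ → sum-replicate-zero p)) (sum-ones p)

sum-indicator-inner : ∀ m {p} (j₀ : Fin p) → ∑[ i < m ] ∑[ j < p ] ι (j₀ == j) ≡ m
sum-indicator-inner m j₀ = trans (sum-cong-≗ {m} (λ _ → sum-indicator j₀)) (sum-ones m)

sum-↑ : ∀ m n (f : Fin (m + n) → ℕ) → sum f ≡ ∑[ i < m ] f (i ↑ˡ n) + ∑[ j < n ] f (m ↑ʳ j)
sum-↑ zero n f = refl
sum-↑ (suc m) n f = trans (cong (f zero +_) (sum-↑ m n (f ∘ suc))) (sym (+-assoc (f zero) _ _))

sum-combine : ∀ m n (f : Fin (m * n) → ℕ) → sum f ≡ ∑[ i < m ] ∑[ j < n ] f (combine i j)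
sum-combine zero n f = refl
sum-combine (suc m) n f = trans (sum-↑ n (m * n) f)
  (cong (sum (λ j → f (j ↑ˡ (m * n))) +_) (sum-combine m n (f ∘ (n ↑ʳ_))))

infixr 5 _⊕_
infixr 6 _⊗_

data Code : Set where
  one : Code
  fin : ℕ → Code
  _⊕_ _⊗_ : Code → Code → Code

El : Code → Set
El one = ⊤
El (fin n) = Fin n
El (a ⊕ b) = El a ⊎ El b
El (a ⊗ b) = El a × El b

card : Code → ℕ
card one = 1
card (fin n) = n
card (a ⊕ b) = card a + card b
card (a ⊗ b) = card a * card b

≟El : ∀ C → DecidableEquality (El C)
≟El one _ _ = yes refl
≟El (fin n) = Finₚ._≟_
≟El (a ⊕ b) = Sumₚ.≡-dec (≟El a) (≟El b)
≟El (a ⊗ b) (x , y) (x' , y') = map′ (uncurry (cong₂ _,_)) ,-injective (≟El a x x' ×-dec ≟El b y y')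

encode : ∀ C → El C → Fin (card C)
encode one tt = zero
encode (fin n) i = i
encode (a ⊕ b) (inj₁ x) = encode a x ↑ˡ card b
encode (a ⊕ b) (inj₂ y) = card a ↑ʳ encode b y
encode (a ⊗ b) (x , y) = combine (encode a x) (encode b y)

decode : ∀ C → Fin (card C) → El C
decode one _ = tt
decode (fin n) i = i
decode (a ⊕ b) i = [ inj₁ ∘ decode a , inj₂ ∘ decode b ]′ (splitAt (card a) i)
decode (a ⊗ b) i = decode a (proj₁ (remQuot {card a} (card b) i)) , decode b (proj₂ (remQuot {card a} (card b) i))

decode-encode : ∀ C x → decode C (encode C x) ≡ x
decode-encode one tt = refl
decode-encode (fin n) i = refl
decode-encode (a ⊕ b) (inj₁ x)
  rewrite Finₚ.splitAt-↑ˡ (card a) (encode a x) (card b) = cong inj₁ (decode-encode a x)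
decode-encode (a ⊕ b) (inj₂ y)
  rewrite Finₚ.splitAt-↑ʳ (card a) (card b) (encode b y) = cong inj₂ (decode-encode b y)
decode-encode (a ⊗ b) (x , y) =
  trans (cong (λ (i , j) → decode a i , decode b j)
               (Finₚ.remQuot-combine {card a} {card b} (encode a x) (encode b y)))
        (cong₂ _,_ (decode-encode a x) (decode-encode b y))

encode-decode : ∀ C i → encode C (decode C i) ≡ i
encode-decode one zero = refl
encode-decode (fin n) i = refl
encode-decode (a ⊕ b) i with splitAt (card a) i in eq
... | inj₁ x = trans (cong (_↑ˡ card b) (encode-decode a x))
  (trans (cong [ _↑ˡ card b , card a ↑ʳ_ ]′ (sym eq)) (Finₚ.join-splitAt (card a) (card b) i))
... | inj₂ y = trans (cong (card a ↑ʳ_) (encode-decode b y))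
  (trans (cong [ _↑ˡ card b , card a ↑ʳ_ ]′ (sym eq)) (Finₚ.join-splitAt (card a) (card b) i))
encode-decode (a ⊗ b) i =
  trans (cong₂ combine (encode-decode a _) (encode-decode b _)) (Finₚ.combine-remQuot {card a} (card b) i)

decode-injective : ∀ C {i j} → decode C i ≡ decode C j → i ≡ j
decode-injective C {i} {j} eq = trans (sym (encode-decode C i)) (trans (cong (encode C) eq) (encode-decode C j))

encode-injective : ∀ C {x y} → encode C x ≡ encode C y → x ≡ y
encode-injective C {x} {y} eq = trans (sym (decode-encode C x)) (trans (cong (decode C) eq) (decode-encode C y))

∑ᴱ : ∀ C → (El C → ℕ) → ℕ
∑ᴱ one f = f tt
∑ᴱ (fin n) f = sum f
∑ᴱ (a ⊕ b) f = ∑ᴱ a (f ∘ inj₁) + ∑ᴱ b (f ∘ inj₂)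
∑ᴱ (a ⊗ b) f = ∑ᴱ a (λ x → ∑ᴱ b (λ y → f (x , y)))

∑ᴱ-cong : ∀ C {f g : El C → ℕ} → (∀ x → f x ≡ g x) → ∑ᴱ C f ≡ ∑ᴱ C g
∑ᴱ-cong one f≡g = f≡g tt
∑ᴱ-cong (fin n) f≡g = sum-cong-≗ f≡g
∑ᴱ-cong (a ⊕ b) f≡g = cong₂ _+_ (∑ᴱ-cong a (f≡g ∘ inj₁)) (∑ᴱ-cong b (f≡g ∘ inj₂))
∑ᴱ-cong (a ⊗ b) f≡g = ∑ᴱ-cong a (λ x → ∑ᴱ-cong b (λ y → f≡g (x , y)))

∑ᴱ-zero : ∀ C {f : El C → ℕ} → (∀ x → f x ≡ 0) → ∑ᴱ C f ≡ 0
∑ᴱ-zero one f≡0 = f≡0 tt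
∑ᴱ-zero (fin n) f≡0 = sum-zero f≡0
∑ᴱ-zero (a ⊕ b) f≡0 = cong₂ _+_ (∑ᴱ-zero a (f≡0 ∘ inj₁)) (∑ᴱ-zero b (f≡0 ∘ inj₂))
∑ᴱ-zero (a ⊗ b) f≡0 = ∑ᴱ-zero a (λ x → ∑ᴱ-zero b (λ y → f≡0 (x , y)))

sum∘decode : ∀ C (f : El C → ℕ) → sum (f ∘ decode C) ≡ ∑ᴱ C f
sum∘decode one f = +-identityʳ (f tt)
sum∘decode (fin n) f = refl
sum∘decode (a ⊕ b) f = begin
  sum (f ∘ decode (a ⊕ b))
    ≡⟨ sum-↑ (card a) (card b) _ ⟩
  ∑[ i < card a ] f (decode (a ⊕ b) (i ↑ˡ card b)) + ∑[ j < card b ] f (decode (a ⊕ b) (card a ↑ʳ j))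
    ≡⟨ cong₂ _+_ (sum-cong-≗ (λ i → cong (f ∘ [ inj₁ ∘ decode a , inj₂ ∘ decode b ]′)
                                         (Finₚ.splitAt-↑ˡ (card a) i (card b))))
                 (sum-cong-≗ (λ j → cong (f ∘ [ inj₁ ∘ decode a , inj₂ ∘ decode b ]′)
                                         (Finₚ.splitAt-↑ʳ (card a) (card b) j))) ⟩
  sum (f ∘ inj₁ ∘ decode a) + sum (f ∘ inj₂ ∘ decode b)
    ≡⟨ cong₂ _+_ (sum∘decode a (f ∘ inj₁)) (sum∘decode b (f ∘ inj₂)) ⟩
  ∑ᴱ (a ⊕ b) f ∎
  where open ≡-Reasoning
sum∘decode (a ⊗ b) f = begin
  sum (f ∘ decode (a ⊗ b))
    ≡⟨ sum-combine (card a) (card b) _ ⟩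
  ∑[ i < card a ] ∑[ j < card b ] f (decode (a ⊗ b) (combine i j))
    ≡⟨ sum-cong-≗ (λ i → sum-cong-≗ (λ j →
         cong (λ (x , y) → f (decode a x , decode b y)) (Finₚ.remQuot-combine {card a} {card b} i j))) ⟩
  ∑[ i < card a ] ∑[ j < card b ] f (decode a i , decode b j)
    ≡⟨ sum-cong-≗ (λ i → sum∘decode b (λ y → f (decode a i , y))) ⟩
  ∑[ i < card a ] ∑ᴱ b (λ y → f (decode a i , y))
    ≡⟨ sum∘decode a (λ x → ∑ᴱ b (λ y → f (x , y))) ⟩
  ∑ᴱ (a ⊗ b) f ∎
  where open ≡-Reasoning

InjectiveOn : ∀ {n} {B : Set} → Subset n → (Fin n → B) → Set
InjectiveOn p f = ∀ {i j} → i ∈ p → j ∈ p → f i ≡ f j → i ≡ j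

injection⇒∣p∣≤∣q∣ : ∀ {m n} (p : Subset m) (q : Subset n) (f : Fin m → Fin n) →
  (∀ {i} → i ∈ p → f i ∈ q) → InjectiveOn p f → ∣ p ∣ ≤ ∣ q ∣
injection⇒∣p∣≤∣q∣ [] q f into inj = z≤n
injection⇒∣p∣≤∣q∣ (outside ∷ p) q f into inj =
  injection⇒∣p∣≤∣q∣ p q (f ∘ suc) (into ∘ there)
    (λ i∈p j∈p eq → Finₚ.suc-injective (inj (there i∈p) (there j∈p) eq))
injection⇒∣p∣≤∣q∣ (inside ∷ p) q f into inj =
  ≤-trans (s≤s ∣p∣≤∣q-f₀∣) (x∈p⇒∣p-x∣<∣p∣ (into here))
  where
  ∣p∣≤∣q-f₀∣ : ∣ p ∣ ≤ ∣ q - f zero ∣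
  ∣p∣≤∣q-f₀∣ = injection⇒∣p∣≤∣q∣ p (q - f zero) (f ∘ suc)
    (λ i∈p → x∈p∧x≢y⇒x∈p-y (into (there i∈p)) (λ eq → Finₚ.0≢1+n (sym (inj (there i∈p) here eq))))
    (λ i∈p j∈p eq → Finₚ.suc-injective (inj (there i∈p) (there j∈p) eq))

inverse⇒∣p∣≡m : ∀ {m n} (p : Subset n) (f : Fin m → Fin n) (g : Fin n → Fin m) →
  (∀ ℓ → f ℓ ∈ p) → (∀ {i} → i ∈ p → f (g i) ≡ i) → (∀ ℓ → g (f ℓ) ≡ ℓ) → ∣ p ∣ ≡ m
inverse⇒∣p∣≡m {m} p f g f∈p fg gf = ≤-antisym ∣p∣≤m m≤∣p∣
  where
  ∣p∣≤m : ∣ p ∣ ≤ m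
  ∣p∣≤m = subst (∣ p ∣ ≤_) (∣⊤∣≡n m) (injection⇒∣p∣≤∣q∣ p full g (λ _ → ∈⊤)
    (λ i∈p j∈p eq → trans (sym (fg i∈p)) (trans (cong f eq) (fg j∈p))))
  m≤∣p∣ : m ≤ ∣ p ∣
  m≤∣p∣ = subst (_≤ ∣ p ∣) (∣⊤∣≡n m) (injection⇒∣p∣≤∣q∣ full p f (λ {ℓ} _ → f∈p ℓ)
    (λ {ℓ} {ℓ'} _ _ eq → trans (sym (gf ℓ)) (trans (cong g eq) (gf ℓ'))))

injectiveOn⇒surjective : ∀ {n m} (p : Subset n) (f : Fin n → Fin m) → ∣ p ∣ ≡ m →
  InjectiveOn p f → ∀ ℓ → ∃ λ i → i ∈ p × f i ≡ ℓ
injectiveOn⇒surjective {m = m} p f ∣p∣≡m inj ℓ with Finₚ.any? (λ i → (i ∈? p) ×-dec (f i Finₚ.≟ ℓ))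
... | yes hit = hit
... | no miss = ⊥-elim (<-irrefl ∣p∣≡m (begin-strict
  ∣ p ∣            ≤⟨ injection⇒∣p∣≤∣q∣ p (full - ℓ) f
                        (λ {i} i∈p → x∈p∧x≢y⇒x∈p-y ∈⊤ (λ fi≡ℓ → miss (i , i∈p , fi≡ℓ))) inj ⟩
  ∣ full {m} - ℓ ∣  <⟨ x∈p⇒∣p-x∣<∣p∣ (∈⊤ {x = ℓ}) ⟩
  ∣ full {m} ∣      ≡⟨ ∣⊤∣≡n m ⟩
  m                ∎))
  where open ≤-Reasoning

cover₂ : ∀ {n} → Fin n → Fin n → List (Subset n) → ℕ
cover₂ u v [] = 0
cover₂ u v (s ∷ P) = ι (lookup s u ∧ lookup s v) + cover₂ u v P

cover₂-sym : ∀ {n} (u v : Fin n) P → cover₂ u v P ≡ cover₂ v u P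
cover₂-sym u v [] = refl
cover₂-sym u v (s ∷ P) = cong₂ _+_ (cong ι (∧-comm (lookup s u) (lookup s v))) (cover₂-sym u v P)

cover₂-transfer : ∀ {n} {Q : Subset n → Set} {P} (u v w : Fin n) → All Q P →
  (∀ {s} → Q s → u ∈ s → v ∈ s → w ∈ s) → (∀ {s} → Q s → v ∈ s → w ∈ s → u ∈ s) →
  cover₂ u v P ≡ cover₂ v w P
cover₂-transfer u v w [] _ _ = refl
cover₂-transfer {P = s ∷ _} u v w (q ∷ qs) uv⇒w vw⇒u = cong₂ _+_
  (cong ι (∧-transfer
    (λ u∈s v∈s → []=⇒lookup (uv⇒w q (lookup⇒[]= u s u∈s) (lookup⇒[]= v s v∈s)))
    (λ v∈s w∈s → []=⇒lookup (vw⇒u q (lookup⇒[]= v s v∈s) (lookup⇒[]= w s w∈s)))))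
  (cover₂-transfer u v w qs uv⇒w vw⇒u)

ι-split : ∀ {n m} (s : Subset n) (v : Fin n) (a : Fin m → Fin n) →
  (v ∈ s → ∃! _≡_ (λ i → a i ∈ s)) →
  ι (lookup s v) ≡ ∑[ i < m ] ι (lookup s v ∧ lookup s (a i))
ι-split {m = m} s v a exactlyOne with lookup s v in v∈s
... | false = sym (sum-replicate-zero m)
... | true with exactlyOne (lookup⇒[]= v s v∈s)
...   | i₀ , aᵢ₀∈s , unique =
  sym (trans (sum-single _ i₀ (λ i i≢i₀ → cong ι (aᵢ∉s i i≢i₀))) (cong ι ([]=⇒lookup aᵢ₀∈s)))
  where
  aᵢ∉s : ∀ i → i ≢ i₀ → lookup s (a i) ≡ false
  aᵢ∉s i i≢i₀ with lookup s (a i) in aᵢ∈s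
  ... | false = refl
  ... | true = ⊥-elim (i≢i₀ (sym (unique (lookup⇒[]= (a i) s aᵢ∈s))))

cover-split : ∀ {n m} {Q : Subset n → Set} {P} (v : Fin n) (a : Fin m → Fin n) → All Q P →
  (∀ {s} → Q s → v ∈ s → ∃! _≡_ (λ i → a i ∈ s)) →
  cover v P ≡ ∑[ i < m ] cover₂ v (a i) P
cover-split {m = m} v a [] _ = sym (sum-replicate-zero m)
cover-split {P = s ∷ P} v a (q ∷ qs) exactlyOne =
  trans (cong₂ _+_ (ι-split s v a (exactlyOne q)) (cover-split v a qs exactlyOne))
        (sym (∑-distrib-+ (λ i → ι (lookup s v ∧ lookup s (a i))) (λ i → cover₂ v (a i) P)))

cover-tabulate : ∀ {m n} (v : Fin n) (f : Fin m → Subset n) →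
  cover v (List.tabulate f) ≡ ∑[ i < m ] ι (lookup (f i) v)
cover-tabulate {zero} v f = refl
cover-tabulate {suc m} v f = cong (ι (lookup (f zero) v) +_) (cover-tabulate v (f ∘ suc))

-- The image of f, with membership decided through a candidate left inverse g.
image : ∀ {m d} → (Fin d → Fin m) → (Fin m → Fin d) → Subset m
image f g = tabulate (λ i → i == f (g i))

module _ {m d} (f : Fin d → Fin m) (g : Fin m → Fin d) where

  ∈-image⁻ : ∀ {i} → i ∈ image f g → f (g i) ≡ i
  ∈-image⁻ {i} i∈ = sym (==⇒≡ (trans (sym (lookup∘tabulate _ i)) ([]=⇒lookup i∈)))

  ∈-image⁺ : (∀ ℓ → g (f ℓ) ≡ ℓ) → ∀ ℓ → f ℓ ∈ image f g
  ∈-image⁺ gf ℓ = lookup⇒[]= (f ℓ) _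
    (trans (lookup∘tabulate _ (f ℓ)) (trans (cong (λ x → f ℓ == f x) (gf ℓ)) (==-refl (f ℓ))))

image-isCopy : ∀ {d} (Γ : Graph) (f : Fin d → Fin (order Γ)) (g : Fin (order Γ) → Fin d) →
  (∀ ℓ → g (f ℓ) ≡ ℓ) → (∀ {ℓ ℓ'} → ℓ ≢ ℓ' → adj Γ (f ℓ) (f ℓ') ≡ true) →
  IsCopyK d Γ (image f g)
image-isCopy Γ f g gf adjacent = inverse⇒∣p∣≡m _ f g (∈-image⁺ f g gf) (∈-image⁻ f g) gf , adjacentOnImage
  where
  adjacentOnImage : ∀ i j → i ∈ image f g → j ∈ image f g → i ≢ j → adj Γ i j ≡ true
  adjacentOnImage i j i∈ j∈ i≢j = subst₂ (λ u v → adj Γ u v ≡ true) (∈-image⁻ f g i∈) (∈-image⁻ f g j∈)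
    (adjacent (λ gi≡gj → i≢j (trans (sym (∈-image⁻ f g i∈)) (trans (cong f gi≡gj) (∈-image⁻ f g j∈)))))

constant-by-steps : ∀ {m} (f : Fin (suc m) → ℕ) → (∀ i → f (suc i) ≡ f (inject₁ i)) → ∀ i → f i ≡ f zero
constant-by-steps f step zero = refl
constant-by-steps {suc m} f step (suc i) =
  trans (step i) (constant-by-steps (f ∘ inject₁) (step ∘ inject₁) i)

-- A, W, B and Y are the multiplicities of the path edges y₀ i x₀ i, x₀ i y₁ i, y₁ i x₁ i
-- and x₁ i y₀ (i+1).
alternating-path-count : ∀ c' (A W : Fin (suc c') → ℕ) (B Y : Fin c' → ℕ) →
  (∀ i → A i + W i ≡ suc c') → (∀ i → W (inject₁ i) + B i ≡ suc c') →
  (∀ i → B i + Y i ≡ suc c') → (∀ i → Y i + A (suc i) ≡ suc c') →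
  sum A ≡ suc c' → W (fromℕ c') ≡ c'
alternating-path-count c' A W B Y A+W W+B B+Y Y+A ∑A = suc-injective (begin
  suc (W (fromℕ c'))           ≡⟨ cong (_+ W (fromℕ c')) (sym (trans (A-constant (fromℕ c')) A₀≡1)) ⟩
  A (fromℕ c') + W (fromℕ c')  ≡⟨ A+W (fromℕ c') ⟩
  suc c'                       ∎)
  where
  open ≡-Reasoning
  A-step : ∀ i → A (suc i) ≡ A (inject₁ i)
  A-step i = trans
    (+-cancelˡ-≡ (Y i) (A (suc i)) (B i) (trans (Y+A i) (trans (sym (B+Y i)) (+-comm (B i) (Y i)))))
    (sym (+-cancelʳ-≡ (W (inject₁ i)) (A (inject₁ i)) (B i)
      (trans (A+W (inject₁ i)) (trans (sym (W+B i)) (+-comm (W (inject₁ i)) (B i))))))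
  A-constant : ∀ i → A i ≡ A zero
  A-constant = constant-by-steps A A-step
  A₀≡1 : A zero ≡ 1
  A₀≡1 = *-cancelˡ-≡ (A zero) 1 (suc c') (begin
    suc c' * A zero           ≡⟨ sum-const (suc c') (A zero) ⟨
    ∑[ i < suc c' ] A zero    ≡⟨ sum-cong-≗ A-constant ⟨
    sum A                     ≡⟨ ∑A ⟩
    suc c'                    ≡⟨ *-identityʳ (suc c') ⟨
    suc c' * 1                ∎)

-- The gadget

module Construction (c' e' k : ℕ) where

  c e d : ℕ
  c = suc c'
  e = suc e'
  d = suc (suc e)

  -- Vertices and copies are given by codes so that they can be enumerated; the pattern synonyms
  -- name their constructors.
  apexCode locCode vertexCode coreCopyCode fillCopyCode blockCode : Code
  apexCode = one ⊕ fin c' ⊕ fin c'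
  locCode = (apexCode ⊗ fin e) ⊕ (fin c ⊕ fin c') ⊕ (fin c ⊕ fin c) ⊕ fin c'
  vertexCode = fin k ⊗ fin d ⊗ locCode
  coreCopyCode = fin c ⊕ (fin c ⊗ fin c') ⊕ fin c' ⊕ (fin c' ⊗ fin c')
  fillCopyCode = (fin c' ⊗ fin c) ⊕ fin c'
  blockCode = fin k ⊗ ((fin d ⊗ coreCopyCode) ⊕ fillCopyCode)

  Apex Loc Vertex CoreCopy FillCopy Block : Set
  Apex = El apexCode
  Loc = El locCode
  Vertex = El vertexCode
  CoreCopy = El coreCopyCode
  FillCopy = El fillCopyCode
  Block = El blockCode

  pattern hub = inj₁ tt
  pattern wing j = inj₂ (inj₁ j)
  pattern bridge j = inj₂ (inj₂ j)

  pattern apex a ℓ = inj₁ (a , ℓ)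
  pattern x₀ i = inj₂ (inj₁ (inj₁ i))
  pattern x₁ i = inj₂ (inj₁ (inj₂ i))
  pattern y₀ i = inj₂ (inj₂ (inj₁ (inj₁ i)))
  pattern y₁ i = inj₂ (inj₂ (inj₁ (inj₂ i)))
  pattern spare u = inj₂ (inj₂ (inj₂ u))

  pattern hubCopy i = inj₁ i
  pattern wingCopy i j = inj₂ (inj₁ (i , j))
  pattern bridgeCopy i = inj₂ (inj₂ (inj₁ i))
  pattern bridgeStepCopy i j = inj₂ (inj₂ (inj₂ (i , j)))

  open BoolEq (≟El apexCode) using () renaming (_==_ to _==ᵃ_; ==-refl to ==ᵃ-refl)
  open BoolEq (≟El locCode) using () renaming (_==_ to _==ˡ_; ==-≢ to ==ˡ-≢)
  open BoolEq (≟El vertexCode) using () renaming (_==_ to _==ᵛ_)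

  layer : Loc → Fin d
  layer (apex _ ℓ) = suc (suc ℓ)
  layer (x₀ _) = 0F
  layer (x₁ _) = 0F
  layer (y₀ _) = 1F
  layer (y₁ _) = 1F
  -- Spare vertices have no core neighbours, so their layer is irrelevant.
  layer (spare _) = 0F

  ApexPath : Apex → Loc → Bool
  ApexPath hub (x₀ _) = true
  ApexPath hub (y₀ _) = true
  ApexPath (wing _) (x₀ _) = true
  ApexPath (wing _) (y₁ _) = true
  ApexPath (bridge _) (x₁ _) = true
  ApexPath (bridge j) (y₁ i) = inject₁ j == i
  ApexPath (bridge _) (y₀ (suc _)) = true
  ApexPath _ _ = false

  PathEdge : Loc → Loc → Bool
  PathEdge (x₀ i) (y₀ i') = i == i'
  PathEdge (x₀ i) (y₁ i') = i == i'
  PathEdge (x₁ i) (y₁ i') = inject₁ i == i'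
  PathEdge (x₁ i) (y₀ i') = suc i == i'
  PathEdge _ _ = false

  Joins : Loc → Loc → Bool
  Joins (apex a _) (apex a' _) = a ==ᵃ a'
  Joins (apex a _) l = ApexPath a l
  Joins l l' = PathEdge l l'

  CoreAdj : Loc → Loc → Bool
  CoreAdj l l' = not (layer l == layer l') ∧ (Joins l l' ∨ Joins l' l)

  IsFill : Loc → Bool
  IsFill (y₀ zero) = true
  IsFill (spare _) = true
  IsFill _ = false

  fillColour : Loc → Fin c
  fillColour (spare u) = suc u
  fillColour _ = zero

  fillVertex : Fin c → Loc
  fillVertex zero = y₀ zero
  fillVertex (suc u) = spare u

  Adj : Vertex → Vertex → Bool
  Adj (g , t , l) (g' , t' , l') = (g == g') ∧ (((t == t') ∧ CoreAdj l l')
    ∨ (IsFill l ∧ (IsFill l' ∧ not ((t == t') ∧ (fillColour l == fillColour l')))))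

  CoreAdj-irrefl : ∀ l → CoreAdj l l ≡ false
  CoreAdj-irrefl l rewrite ==-refl (layer l) = refl

  CoreAdj-sym : ∀ l l' → CoreAdj l l' ≡ CoreAdj l' l
  CoreAdj-sym l l' = cong₂ (λ p q → not p ∧ q) (==-sym (layer l) (layer l')) (∨-comm (Joins l l') (Joins l' l))

  Adj-irrefl : ∀ v → Adj v v ≡ false
  Adj-irrefl (g , t , l) rewrite ==-refl g | ==-refl t | CoreAdj-irrefl l | ==-refl (fillColour l)
    with IsFill l
  ... | true = refl
  ... | false = refl

  Adj-sym : ∀ v v' → Adj v v' ≡ Adj v' v
  Adj-sym (g , t , l) (g' , t' , l')
    rewrite ==-sym g g' | ==-sym t t' | CoreAdj-sym l l' | ==-sym (fillColour l) (fillColour l')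
    with IsFill l | IsFill l'
  ... | true  | true  = refl
  ... | true  | false = refl
  ... | false | true  = refl
  ... | false | false = refl

  n : ℕ
  n = card vertexCode

  pos : Vertex → Fin n
  pos = encode vertexCode

  vtx : Fin n → Vertex
  vtx = decode vertexCode

  Γ : Graph
  Γ = record
    { n = n
    ; adj = λ i j → Adj (vtx i) (vtx j)
    ; sym = λ i j → Adj-sym (vtx i) (vtx j)
    ; irrefl = λ i → Adj-irrefl (vtx i)
    }

  portalVertex : Fin (k * d) → Vertex
  portalVertex i = proj₁ (remQuot {k} d i) , proj₂ (remQuot {k} d i) , y₁ (fromℕ c')

  portalVertex-injective : ∀ {i j} → portalVertex i ≡ portalVertex j → i ≡ j
  portalVertex-injective {i} {j} eq = trans (sym (Finₚ.combine-remQuot {k} d i))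
    (trans (cong (λ (g , t , _) → combine g t) eq) (Finₚ.combine-remQuot {k} d j))

  G : Gadget (k * d)
  G = record
    { graph = Γ
    ; portal = pos ∘ portalVertex
    ; portalInj = portalVertex-injective ∘ encode-injective vertexCode
    }

  -- The canonical packing

  coreApex : CoreCopy → Apex
  coreApex (hubCopy _) = hub
  coreApex (wingCopy _ j) = wing j
  coreApex (bridgeCopy i) = bridge i
  coreApex (bridgeStepCopy _ j) = bridge j

  coreX coreY : CoreCopy → Loc
  coreX (hubCopy i) = x₀ i
  coreX (wingCopy i _) = x₀ i
  coreX (bridgeCopy i) = x₁ i
  coreX (bridgeStepCopy i _) = x₁ i
  coreY (hubCopy i) = y₀ i
  coreY (wingCopy i _) = y₁ i
  coreY (bridgeCopy i) = y₁ (inject₁ i)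
  coreY (bridgeStepCopy i _) = y₀ (suc i)

  coreMember : CoreCopy → Fin d → Loc
  coreMember τ 0F = coreX τ
  coreMember τ 1F = coreY τ
  coreMember τ (suc (suc ℓ)) = apex (coreApex τ) ℓ

  layer-coreMember : ∀ τ ℓ → layer (coreMember τ ℓ) ≡ ℓ
  layer-coreMember (hubCopy _) 0F = refl
  layer-coreMember (wingCopy _ _) 0F = refl
  layer-coreMember (bridgeCopy _) 0F = refl
  layer-coreMember (bridgeStepCopy _ _) 0F = refl
  layer-coreMember (hubCopy _) 1F = refl
  layer-coreMember (wingCopy _ _) 1F = refl
  layer-coreMember (bridgeCopy _) 1F = refl
  layer-coreMember (bridgeStepCopy _ _) 1F = refl
  layer-coreMember τ (suc (suc ℓ)) = refl

  joins-coreXY : ∀ τ → Joins (coreX τ) (coreY τ) ≡ true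
  joins-coreXY (hubCopy i) = ==-refl i
  joins-coreXY (wingCopy i _) = ==-refl i
  joins-coreXY (bridgeCopy i) = ==-refl (inject₁ i)
  joins-coreXY (bridgeStepCopy i _) = ==-refl (suc i)

  joins-apexX : ∀ τ ℓ → Joins (apex (coreApex τ) ℓ) (coreX τ) ≡ true
  joins-apexX (hubCopy _) _ = refl
  joins-apexX (wingCopy _ _) _ = refl
  joins-apexX (bridgeCopy _) _ = refl
  joins-apexX (bridgeStepCopy _ _) _ = refl

  joins-apexY : ∀ τ ℓ → Joins (apex (coreApex τ) ℓ) (coreY τ) ≡ true
  joins-apexY (hubCopy _) _ = refl
  joins-apexY (wingCopy _ _) _ = refl
  joins-apexY (bridgeCopy i) _ = ==-refl (inject₁ i)
  joins-apexY (bridgeStepCopy _ _) _ = refl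

  coreMember-joins : ∀ τ ℓ ℓ' → ℓ ≢ ℓ' →
    (Joins (coreMember τ ℓ) (coreMember τ ℓ') ∨ Joins (coreMember τ ℓ') (coreMember τ ℓ)) ≡ true
  coreMember-joins τ 0F 0F ℓ≢ℓ' = ⊥-elim (ℓ≢ℓ' refl)
  coreMember-joins τ 0F 1F _ = ∨-trueˡ _ (joins-coreXY τ)
  coreMember-joins τ 0F (suc (suc ℓ)) _ = ∨-trueʳ _ (joins-apexX τ ℓ)
  coreMember-joins τ 1F 0F _ = ∨-trueʳ _ (joins-coreXY τ)
  coreMember-joins τ 1F 1F ℓ≢ℓ' = ⊥-elim (ℓ≢ℓ' refl)
  coreMember-joins τ 1F (suc (suc ℓ)) _ = ∨-trueʳ _ (joins-apexY τ ℓ)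
  coreMember-joins τ (suc (suc ℓ)) 0F _ = ∨-trueˡ _ (joins-apexX τ ℓ)
  coreMember-joins τ (suc (suc ℓ)) 1F _ = ∨-trueˡ _ (joins-apexY τ ℓ)
  coreMember-joins τ (suc (suc ℓ)) (suc (suc ℓ')) _ = ∨-trueˡ _ (==ᵃ-refl (coreApex τ))

  coreMember-adjacent : ∀ τ {ℓ ℓ'} → ℓ ≢ ℓ' → CoreAdj (coreMember τ ℓ) (coreMember τ ℓ') ≡ true
  coreMember-adjacent τ {ℓ} {ℓ'} ℓ≢ℓ'
    rewrite layer-coreMember τ ℓ | layer-coreMember τ ℓ' | ==-≢ ℓ≢ℓ' = coreMember-joins τ ℓ ℓ' ℓ≢ℓ'

  readCoreCopy : Apex → Loc → Loc → CoreCopy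
  readCoreCopy (wing j) (x₀ i) (y₁ _) = wingCopy i j
  readCoreCopy (bridge j) (x₁ i) (y₀ _) = bridgeStepCopy i j
  readCoreCopy _ (x₁ i) _ = bridgeCopy i
  readCoreCopy _ (x₀ i) _ = hubCopy i
  readCoreCopy _ _ _ = hubCopy zero

  readCoreCopy-parts : ∀ τ → readCoreCopy (coreApex τ) (coreX τ) (coreY τ) ≡ τ
  readCoreCopy-parts (hubCopy _) = refl
  readCoreCopy-parts (wingCopy _ _) = refl
  readCoreCopy-parts (bridgeCopy _) = refl
  readCoreCopy-parts (bridgeStepCopy _ _) = refl

  apex-injectiveˡ : ∀ {a a' ℓ ℓ'} → _≡_ {A = Loc} (apex a ℓ) (apex a' ℓ') → a ≡ a'
  apex-injectiveˡ refl = refl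

  coreMember-injective : ∀ {τ τ'} → (∀ ℓ → coreMember τ ℓ ≡ coreMember τ' ℓ) → τ ≡ τ'
  coreMember-injective {τ} {τ'} same = begin
    τ
      ≡⟨ readCoreCopy-parts τ ⟨
    readCoreCopy (coreApex τ) (coreX τ) (coreY τ)
      ≡⟨ cong₂ (λ a (x , y) → readCoreCopy a x y) (apex-injectiveˡ (same 2F)) (cong₂ _,_ (same 0F) (same 1F)) ⟩
    readCoreCopy (coreApex τ') (coreX τ') (coreY τ')
      ≡⟨ readCoreCopy-parts τ' ⟩
    τ' ∎
    where open ≡-Reasoning

  -- Fill copies are the colour pairs (firstColour, restColour) ≠ (0, 0).
  firstColour restColour : FillCopy → Fin c
  firstColour (inj₁ (a , _)) = suc a
  firstColour (inj₂ _) = zero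
  restColour (inj₁ (_ , b)) = b
  restColour (inj₂ b) = suc b

  slotColour : FillCopy → Fin d → Fin c
  slotColour φ t = if t == 1F then firstColour φ else restColour φ

  fillColours-injective : ∀ {φ φ'} → firstColour φ ≡ firstColour φ' → restColour φ ≡ restColour φ' → φ ≡ φ'
  fillColours-injective {inj₁ _} {inj₁ _} refl refl = refl
  fillColours-injective {inj₂ _} {inj₂ _} _ refl = refl
  fillColours-injective {inj₁ _} {inj₂ _} () _
  fillColours-injective {inj₂ _} {inj₁ _} () _

  IsFill-fillVertex : ∀ a → IsFill (fillVertex a) ≡ true
  IsFill-fillVertex zero = refl
  IsFill-fillVertex (suc _) = refl

  fillColour-fillVertex : ∀ a → fillColour (fillVertex a) ≡ a
  fillColour-fillVertex zero = refl
  fillColour-fillVertex (suc _) = refl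

  fillVertex-injective : ∀ {a b} → fillVertex a ≡ fillVertex b → a ≡ b
  fillVertex-injective {a} {b} eq =
    trans (sym (fillColour-fillVertex a)) (trans (cong fillColour eq) (fillColour-fillVertex b))

  IsFill-coreX : ∀ τ → IsFill (coreX τ) ≡ false
  IsFill-coreX (hubCopy _) = refl
  IsFill-coreX (wingCopy _ _) = refl
  IsFill-coreX (bridgeCopy _) = refl
  IsFill-coreX (bridgeStepCopy _ _) = refl

  -- member b lists block b, a core copy by layers and a fill copy by slots.
  member : Block → Fin d → Vertex
  member (g , inj₁ (t , τ)) ℓ = g , t , coreMember τ ℓ
  member (g , inj₂ φ) t = g , t , fillVertex (slotColour φ t)

  memberIndex : Block → Vertex → Fin d
  memberIndex (_ , inj₁ _) (_ , _ , l) = layer l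
  memberIndex (_ , inj₂ _) (_ , t , _) = t

  memberIndex-member : ∀ b ℓ → memberIndex b (vtx (pos (member b ℓ))) ≡ ℓ
  memberIndex-member b ℓ rewrite decode-encode vertexCode (member b ℓ) with b
  ... | _ , inj₁ (_ , τ) = layer-coreMember τ ℓ
  ... | _ , inj₂ _ = refl

  member-adjacent : ∀ b {ℓ ℓ'} → ℓ ≢ ℓ' → Adj (member b ℓ) (member b ℓ') ≡ true
  member-adjacent (g , inj₁ (t , τ)) ℓ≢ℓ' rewrite ==-refl g | ==-refl t | coreMember-adjacent τ ℓ≢ℓ' = refl
  member-adjacent (g , inj₂ φ) {t} {t'} t≢t'
    rewrite ==-refl g | ==-≢ t≢t' | IsFill-fillVertex (slotColour φ t) | IsFill-fillVertex (slotColour φ t') = refl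

  block : Block → Subset n
  block b = image (pos ∘ member b) (memberIndex b ∘ vtx)

  block-isCopy : ∀ b → IsCopyK d Γ (block b)
  block-isCopy b = image-isCopy Γ (pos ∘ member b) (memberIndex b ∘ vtx) (memberIndex-member b)
    (λ {ℓ} {ℓ'} ℓ≢ℓ' → subst₂ (λ u v → Adj u v ≡ true)
      (sym (decode-encode vertexCode (member b ℓ))) (sym (decode-encode vertexCode (member b ℓ')))
      (member-adjacent b ℓ≢ℓ'))

  members-determine : ∀ b b' → (∀ ℓ → member b' (memberIndex b' (member b ℓ)) ≡ member b ℓ) → b ≡ b'
  members-determine (g , inj₁ (t , τ)) (g' , inj₁ (t' , τ')) same = sym
    (cong₂ (λ g (t , τ) → g , inj₁ (t , τ)) (cong proj₁ (same' 0F))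
      (cong₂ _,_ (cong (proj₁ ∘ proj₂) (same' 0F)) (coreMember-injective (cong (proj₂ ∘ proj₂) ∘ same'))))
    where
    same' : ∀ ℓ → (g' , t' , coreMember τ' ℓ) ≡ (g , t , coreMember τ ℓ)
    same' ℓ = trans (cong (λ ℓ' → g' , t' , coreMember τ' ℓ') (sym (layer-coreMember τ ℓ))) (same ℓ)
  members-determine (g , inj₁ (t , τ)) (g' , inj₂ φ) same =
    ⊥-elim (true≢false (begin
      true                                     ≡⟨ IsFill-fillVertex (slotColour φ t) ⟨
      IsFill (fillVertex (slotColour φ t))     ≡⟨ cong (IsFill ∘ proj₂ ∘ proj₂) (same 0F) ⟩
      IsFill (coreX τ)                         ≡⟨ IsFill-coreX τ ⟩
      false                                    ∎))
    where open ≡-Reasoning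
  members-determine (g , inj₂ φ) (g' , inj₁ (t' , τ')) same =
    ⊥-elim (0≢1 (trans (sym (cong (proj₁ ∘ proj₂) (same 0F))) (cong (proj₁ ∘ proj₂) (same 1F))))
    where 0≢1 : ¬ (_≡_ {A = Fin d} 0F 1F)
          0≢1 ()
  members-determine (g , inj₂ φ) (g' , inj₂ φ') same = sym
    (cong₂ (λ g φ → g , inj₂ φ) (cong proj₁ (same 0F)) (fillColours-injective (colour≡ 1F) (colour≡ 0F)))
    where
    colour≡ : ∀ t → slotColour φ' t ≡ slotColour φ t
    colour≡ t = fillVertex-injective (cong (proj₂ ∘ proj₂) (same t))

  block-injective : ∀ {b b'} → block b ≡ block b' → b ≡ b'
  block-injective {b} {b'} eq = members-determine b b' λ ℓ →
    encode-injective vertexCode (trans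
      (cong (λ v → pos (member b' (memberIndex b' v))) (sym (decode-encode vertexCode (member b ℓ))))
      (∈-image⁻ (pos ∘ member b') (memberIndex b' ∘ vtx)
        (subst (pos (member b ℓ) ∈_) eq
          (∈-image⁺ (pos ∘ member b) (memberIndex b ∘ vtx) (memberIndex-member b) ℓ))))

  canonical : List (Subset n)
  canonical = List.tabulate (block ∘ decode blockCode)

  canonical-copies : All (IsCopyK d Γ) canonical
  canonical-copies = Allₚ.tabulate⁺ (block-isCopy ∘ decode blockCode)

  canonical-unique : Unique canonical
  canonical-unique = Uniqueₚ.tabulate⁺ (decode-injective blockCode ∘ block-injective)

  inCoreCopy : CoreCopy → Loc → Bool
  inCoreCopy τ l = l ==ˡ coreMember τ (layer l)

  inFillCopy : FillCopy → Fin d → Loc → Bool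
  inFillCopy φ t l = l ==ˡ fillVertex (slotColour φ t)

  coreCount : Loc → ℕ
  coreCount l = ∑ᴱ coreCopyCode (λ τ → ι (inCoreCopy τ l))

  fillCount : Fin d → Loc → ℕ
  fillCount t l = ∑ᴱ fillCopyCode (λ φ → ι (inFillCopy φ t l))

  lookup-block : ∀ b v → lookup (block b) (pos v) ≡ (v ==ᵛ member b (memberIndex b v))
  lookup-block b v = begin
    lookup (block b) (pos v)                             ≡⟨ lookup∘tabulate _ (pos v) ⟩
    pos v == pos (member b (memberIndex b (vtx (pos v)))) ≡⟨ cong (λ w → pos v == pos (member b (memberIndex b w)))
                                                              (decode-encode vertexCode v) ⟩
    pos v == pos (member b (memberIndex b v))            ≡⟨ does-⇔ (mk⇔ (encode-injective vertexCode) (cong pos))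
                                                              (pos v Finₚ.≟ _) (≟El vertexCode v _) ⟩
    v ==ᵛ member b (memberIndex b v)                     ∎
    where open ≡-Reasoning

  cover-canonical : ∀ g t l → cover (pos (g , t , l)) canonical ≡ coreCount l + fillCount t l
  cover-canonical g t l = begin
    cover (pos (g , t , l)) canonical
      ≡⟨ cover-tabulate (pos (g , t , l)) (block ∘ decode blockCode) ⟩
    sum (λ i → ι (lookup (block (decode blockCode i)) (pos (g , t , l))))
      ≡⟨ sum∘decode blockCode (λ b → ι (lookup (block b) (pos (g , t , l)))) ⟩
    ∑ᴱ blockCode (λ b → ι (lookup (block b) (pos (g , t , l))))
      ≡⟨ ∑ᴱ-cong blockCode (λ b → cong ι (lookup-block b (g , t , l))) ⟩
    ∑[ g' < k ] (∑[ t' < d ] coreTerm (g == g') t' + fillTerm (g == g'))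
      ≡⟨ sum-pick g (λ b _ → ∑[ t' < d ] coreTerm b t' + fillTerm b)
           (λ _ → cong₂ _+_ (sum-zero {d} (λ _ → ∑ᴱ-zero coreCopyCode (λ _ → refl)))
                            (∑ᴱ-zero fillCopyCode (λ _ → refl))) ⟩
    ∑[ t' < d ] coreTerm true t' + fillTerm true
      ≡⟨ cong₂ _+_ (sum-pick t (λ b _ → ∑ᴱ coreCopyCode (λ τ → ι (b ∧ inCoreCopy τ l)))
                             (λ _ → ∑ᴱ-zero coreCopyCode (λ _ → refl)))
                   (cong (λ b → ∑ᴱ fillCopyCode (λ φ → ι (b ∧ inFillCopy φ t l))) (==-refl t)) ⟩
    coreCount l + fillCount t l
      ∎
    where
    open ≡-Reasoning
    coreTerm : Bool → Fin d → ℕ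
    coreTerm b t' = ∑ᴱ coreCopyCode (λ τ → ι (b ∧ ((t == t') ∧ inCoreCopy τ l)))
    fillTerm : Bool → ℕ
    fillTerm b = ∑ᴱ fillCopyCode (λ φ → ι (b ∧ ((t == t) ∧ inFillCopy φ t l)))

  ∑-coreCopies : ∀ (f : CoreCopy → ℕ) {h w b s} →
    ∑[ i < c ] f (hubCopy i) ≡ h → ∑[ i < c ] ∑[ j < c' ] f (wingCopy i j) ≡ w →
    ∑[ i < c' ] f (bridgeCopy i) ≡ b → ∑[ i < c' ] ∑[ j < c' ] f (bridgeStepCopy i j) ≡ s →
    ∑ᴱ coreCopyCode f ≡ h + (w + (b + s))
  ∑-coreCopies f h w b s = cong₂ _+_ h (cong₂ _+_ w (cong₂ _+_ b s))

  coreCount≡ : ∀ l {h w b s} →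
    ∑[ i < c ] ι (inCoreCopy (hubCopy i) l) ≡ h →
    ∑[ i < c ] ∑[ j < c' ] ι (inCoreCopy (wingCopy i j) l) ≡ w →
    ∑[ i < c' ] ι (inCoreCopy (bridgeCopy i) l) ≡ b →
    ∑[ i < c' ] ∑[ j < c' ] ι (inCoreCopy (bridgeStepCopy i j) l) ≡ s →
    coreCount l ≡ h + (w + (b + s))
  coreCount≡ l = ∑-coreCopies (λ τ → ι (inCoreCopy τ l))

  inCoreCopy-apex : ∀ τ a ℓ → inCoreCopy τ (apex a ℓ) ≡ (a ==ᵃ coreApex τ)
  inCoreCopy-apex τ a ℓ = trans (cong ((a ==ᵃ coreApex τ) ∧_) (==-refl ℓ)) (∧-identityʳ _)

  inject₁-== : ∀ {m} (i j : Fin m) → (inject₁ i == inject₁ j) ≡ (i == j)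
  inject₁-== i j = does-⇔ (mk⇔ Finₚ.inject₁-injective (cong inject₁)) (inject₁ i Finₚ.≟ inject₁ j) (i Finₚ.≟ j)

  coreCount-apex : ∀ a ℓ → coreCount (apex a ℓ) ≡ c
  coreCount-apex a ℓ = trans (∑ᴱ-cong coreCopyCode (λ τ → cong ι (inCoreCopy-apex τ a ℓ))) (apexCount a)
    where
    apexCount : ∀ a → ∑ᴱ coreCopyCode (λ τ → ι (a ==ᵃ coreApex τ)) ≡ c
    apexCount hub = trans (∑-coreCopies (λ τ → ι (hub ==ᵃ coreApex τ))
      (sum-ones c) (sum-zero² c c') (sum-replicate-zero c') (sum-zero² c' c')) (+-identityʳ c)
    apexCount (wing j) = trans (∑-coreCopies (λ τ → ι (wing j ==ᵃ coreApex τ))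
      (sum-replicate-zero c) (sum-indicator-inner c j) (sum-replicate-zero c') (sum-zero² c' c')) (+-identityʳ c)
    apexCount (bridge j) = ∑-coreCopies (λ τ → ι (bridge j ==ᵃ coreApex τ))
      (sum-replicate-zero c) (sum-zero² c c') (sum-indicator j) (sum-indicator-inner c' j)

  coreCount-x₀ : ∀ i → coreCount (x₀ i) ≡ c
  coreCount-x₀ i = trans (coreCount≡ (x₀ i) (sum-indicator i) (sum-indicator-outer i c')
    (sum-replicate-zero c') (sum-zero² c' c')) (cong suc (+-identityʳ c'))

  coreCount-x₁ : ∀ i → coreCount (x₁ i) ≡ c
  coreCount-x₁ i = coreCount≡ (x₁ i)
    (sum-replicate-zero c) (sum-zero² c c') (sum-indicator i) (sum-indicator-outer i c')

  coreCount-y₀-zero : coreCount (y₀ zero) ≡ 1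
  coreCount-y₀-zero = coreCount≡ (y₀ zero)
    (sum-indicator {c} zero) (sum-zero² c c') (sum-replicate-zero c') (sum-zero² c' c')

  coreCount-y₀-suc : ∀ i → coreCount (y₀ (suc i)) ≡ c
  coreCount-y₀-suc i = coreCount≡ (y₀ (suc i)) (sum-indicator (suc i)) (sum-zero² c c') (sum-replicate-zero c')
    (sum-indicator-outer i c')

  coreCount-y₁-inject₁ : ∀ i → coreCount (y₁ (inject₁ i)) ≡ c
  coreCount-y₁-inject₁ i = trans (coreCount≡ (y₁ (inject₁ i)) (sum-replicate-zero c) (sum-indicator-outer (inject₁ i) c')
    (trans (sum-cong-≗ (λ i' → cong ι (inject₁-== i i'))) (sum-indicator i)) (sum-zero² c' c')) (+-comm c' 1)

  coreCount-portal : coreCount (y₁ (fromℕ c')) ≡ c'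
  coreCount-portal = trans (coreCount≡ (y₁ (fromℕ c')) (sum-replicate-zero c) (sum-indicator-outer (fromℕ c') c')
    (sum-zero {c'} (λ i → cong ι (==-≢ (Finₚ.fromℕ≢inject₁ {i = i})))) (sum-zero² c' c')) (+-identityʳ c')

  coreCount-spare : ∀ u → coreCount (spare u) ≡ 0
  coreCount-spare u = coreCount≡ (spare u)
    (sum-replicate-zero c) (sum-zero² c c') (sum-replicate-zero c') (sum-zero² c' c')

  fillCount-nonFill : ∀ t l → IsFill l ≡ false → fillCount t l ≡ 0
  fillCount-nonFill t l notFill = ∑ᴱ-zero fillCopyCode λ φ → cong ι (==ˡ-≢ λ l≡ →
    true≢false (trans (sym (IsFill-fillVertex (slotColour φ t))) (trans (cong IsFill (sym l≡)) notFill)))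

  fillCount-fillVertex : ∀ t u → fillCount t (fillVertex u) ≡ ∑ᴱ fillCopyCode (λ φ → ι (u == slotColour φ t))
  fillCount-fillVertex t u = ∑ᴱ-cong fillCopyCode λ φ → cong ι
    (does-⇔ (mk⇔ fillVertex-injective (cong fillVertex)) (≟El locCode (fillVertex u) _) (u Finₚ.≟ slotColour φ t))

  fillCount-y₀-zero : ∀ t → fillCount t (y₀ zero) ≡ c'
  fillCount-y₀-zero t = trans (fillCount-fillVertex t zero) (colourCount t)
    where
    colourCount : ∀ t → ∑ᴱ fillCopyCode (λ φ → ι (zero == slotColour φ t)) ≡ c'
    colourCount t with t == 1F
    ... | true = cong₂ _+_ (sum-zero² c' c) (sum-ones c')
    ... | false = trans (cong₂ _+_ (sum-indicator-inner c' {c} zero) (sum-replicate-zero c')) (+-identityʳ c')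

  fillCount-spare : ∀ t u → fillCount t (spare u) ≡ c
  fillCount-spare t u = trans (fillCount-fillVertex t (suc u)) (colourCount t)
    where
    colourCount : ∀ t → ∑ᴱ fillCopyCode (λ φ → ι (suc u == slotColour φ t)) ≡ c
    colourCount t with t == 1F
    ... | true = trans (cong₂ _+_ (sum-indicator-outer u c) (sum-replicate-zero c')) (+-identityʳ c)
    ... | false = trans (cong₂ _+_ (sum-indicator-inner c' (suc u)) (sum-indicator u)) (+-comm c' 1)

  cover-canonical-internal : ∀ g t l → l ≢ y₁ (fromℕ c') → cover (pos (g , t , l)) canonical ≡ c
  cover-canonical-internal g t l l≢portal = trans (cover-canonical g t l) (count l l≢portal)
    where
    coreOnly : ∀ l → IsFill l ≡ false → coreCount l ≡ c → coreCount l + fillCount t l ≡ c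
    coreOnly l notFill core = trans (cong₂ _+_ core (fillCount-nonFill t l notFill)) (+-identityʳ c)
    count : ∀ l → l ≢ y₁ (fromℕ c') → coreCount l + fillCount t l ≡ c
    count (apex a ℓ) _ = coreOnly (apex a ℓ) refl (coreCount-apex a ℓ)
    count (x₀ i) _ = coreOnly (x₀ i) refl (coreCount-x₀ i)
    count (x₁ i) _ = coreOnly (x₁ i) refl (coreCount-x₁ i)
    count (y₀ zero) _ = cong₂ _+_ coreCount-y₀-zero (fillCount-y₀-zero t)
    count (y₀ (suc i)) _ = coreOnly (y₀ (suc i)) refl (coreCount-y₀-suc i)
    count (y₁ u) u≢last with view u
    ... | ‵fromℕ = ⊥-elim (u≢last refl)
    ... | ‵inject₁ i = coreOnly (y₁ (inject₁ i)) refl (coreCount-y₁-inject₁ i)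
    count (spare u) _ = cong₂ _+_ (coreCount-spare u) (fillCount-spare t u)

  cover-canonical-portal : ∀ g t → cover (pos (g , t , y₁ (fromℕ c'))) canonical ≡ c'
  cover-canonical-portal g t = trans (cover-canonical g t (y₁ (fromℕ c')))
    (trans (cong₂ _+_ coreCount-portal (fillCount-nonFill t (y₁ (fromℕ c')) refl)) (+-identityʳ c'))

  -- Packings force the portal value

  Adj-sameSlot : ∀ {g t l l'} → Adj (g , t , l) (g , t , l') ≡ true →
    CoreAdj l l' ≡ true ⊎ (IsFill l ≡ true × IsFill l' ≡ true)
  Adj-sameSlot {g} {t} {l} {l'} adj rewrite ==-refl g | ==-refl t with ∨-true⁻ adj
  ... | inj₁ core = inj₁ core
  ... | inj₂ fill = inj₂ (proj₁ (∧-true⁻ fill) , proj₁ (∧-true⁻ {IsFill l'} (proj₂ (∧-true⁻ {IsFill l} fill))))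

  Adj-nonFill : ∀ {g t l₀ v} → IsFill l₀ ≡ false → Adj (g , t , l₀) v ≡ true →
    ∃ λ l → v ≡ (g , t , l) × CoreAdj l₀ l ≡ true
  Adj-nonFill {g} {t} {l₀} {g' , t' , l} notFill adj rewrite notFill with ∧-true⁻ adj
  ... | g==g' , slotAdj with ∧-true⁻ (∨-false⁻ slotAdj)
  ...   | t==t' , core with refl ← ==⇒≡ {x = g} {g'} g==g' | refl ← ==⇒≡ {x = t} {t'} t==t' = l , refl , core

  CoreAdj⇒layer≢ : ∀ {l l'} → CoreAdj l l' ≡ true → layer l ≢ layer l'
  CoreAdj⇒layer≢ {l} {l'} adj same = true≢false (begin
    true                       ≡⟨ proj₁ (∧-true⁻ adj) ⟨
    not (layer l == layer l')  ≡⟨ cong not (dec-true (layer l Finₚ.≟ layer l') same) ⟩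
    false                      ∎)
    where open ≡-Reasoning

  CoreAdj-spare : ∀ l u → CoreAdj l (spare u) ≡ false
  CoreAdj-spare (apex hub _) _ = refl
  CoreAdj-spare (apex (wing _) _) _ = refl
  CoreAdj-spare (apex (bridge _) _) _ = refl
  CoreAdj-spare (x₀ _) _ = refl
  CoreAdj-spare (x₁ _) _ = refl
  CoreAdj-spare (y₀ _) _ = refl
  CoreAdj-spare (y₁ _) _ = refl
  CoreAdj-spare (spare _) _ = refl

  coreNeighbour-fill : ∀ {l₀ l} → CoreAdj l₀ l ≡ true → IsFill l ≡ true → l ≡ y₀ zero
  coreNeighbour-fill {l = y₀ zero} _ _ = refl
  coreNeighbour-fill {l₀} {spare u} adj _ = ⊥-elim (true≢false (trans (sym adj) (CoreAdj-spare l₀ u)))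
  coreNeighbour-fill {l = apex _ _} _ ()
  coreNeighbour-fill {l = x₀ _} _ ()
  coreNeighbour-fill {l = x₁ _} _ ()
  coreNeighbour-fill {l = y₀ (suc _)} _ ()
  coreNeighbour-fill {l = y₁ _} _ ()

  location : Fin n → Loc
  location i = proj₂ (proj₂ (vtx i))

  -- A copy of K_d through a non-fill vertex of slot (g, t) lies in the core of that slot, up to
  -- y₀ 0, and meets every layer once.
  module InCopy {s} (s-copy : IsCopyK d Γ s) {g t l₀} (l₀-core : IsFill l₀ ≡ false)
                (l₀∈s : pos (g , t , l₀) ∈ s) where

    member-near : ∀ {i} → i ∈ s → ∃ λ l → vtx i ≡ (g , t , l) × (l ≡ l₀ ⊎ CoreAdj l₀ l ≡ true)
    member-near {i} i∈s with i Finₚ.≟ pos (g , t , l₀)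
    ... | yes refl = l₀ , decode-encode vertexCode _ , inj₁ refl
    ... | no i≢l₀ with Adj-nonFill {g} {t} {l₀} {vtx i} l₀-core
                         (subst (λ v → Adj v (vtx i) ≡ true) (decode-encode vertexCode (g , t , l₀))
                                             (proj₂ s-copy _ _ l₀∈s i∈s (i≢l₀ ∘ sym)))
    ...   | l , vtx≡ , adj = l , vtx≡ , inj₂ adj

    near-fill : ∀ {l} → l ≡ l₀ ⊎ CoreAdj l₀ l ≡ true → IsFill l ≡ true → l ≡ y₀ zero
    near-fill (inj₁ refl) fill = ⊥-elim (true≢false (trans (sym fill) l₀-core))
    near-fill (inj₂ adj) fill = coreNeighbour-fill {l₀} adj fill

    layer-injective : InjectiveOn s (layer ∘ location)
    layer-injective {i} {j} i∈s j∈s same with i Finₚ.≟ j | member-near i∈s | member-near j∈s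
    ... | yes i≡j | _ | _ = i≡j
    ... | no i≢j | lᵢ , vtxᵢ≡ , nearᵢ | lⱼ , vtxⱼ≡ , nearⱼ
      with Adj-sameSlot {g} {t} (subst₂ (λ u v → Adj u v ≡ true) vtxᵢ≡ vtxⱼ≡ (proj₂ s-copy i j i∈s j∈s i≢j))
    ...   | inj₁ core = ⊥-elim (CoreAdj⇒layer≢ core
            (subst₂ (λ u v → layer (proj₂ (proj₂ u)) ≡ layer (proj₂ (proj₂ v))) vtxᵢ≡ vtxⱼ≡ same))
    ...   | inj₂ (fillᵢ , fillⱼ) = ⊥-elim (i≢j (decode-injective vertexCode (begin
            vtx i          ≡⟨ vtxᵢ≡ ⟩
            g , t , lᵢ     ≡⟨ cong (λ l → g , t , l) (trans (near-fill nearᵢ fillᵢ) (sym (near-fill nearⱼ fillⱼ))) ⟩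
            g , t , lⱼ     ≡⟨ vtxⱼ≡ ⟨
            vtx j          ∎)))
      where open ≡-Reasoning

    partner : ∀ ℓ → layer l₀ ≢ ℓ → ∃ λ l → pos (g , t , l) ∈ s × CoreAdj l₀ l ≡ true × layer l ≡ ℓ
    partner ℓ ℓ≢ with injectiveOn⇒surjective s (layer ∘ location) (proj₁ s-copy) layer-injective ℓ
    ... | i , i∈s , layer≡ℓ with member-near i∈s
    ...   | l , vtx≡ , inj₁ refl = ⊥-elim (ℓ≢ (trans (cong (layer ∘ proj₂ ∘ proj₂) (sym vtx≡)) layer≡ℓ))
    ...   | l , vtx≡ , inj₂ adj =
      l , subst (_∈ s) (trans (sym (encode-decode vertexCode i)) (cong pos vtx≡)) i∈s , adj ,
      trans (cong (layer ∘ proj₂ ∘ proj₂) (sym vtx≡)) layer≡ℓ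

  record LayerNeighbours (l₀ : Loc) (ℓ : Fin d) {m} (a : Fin m → Loc) : Set where
    field
      layer≢ : layer l₀ ≢ ℓ
      in-layer : ∀ i → layer (a i) ≡ ℓ
      complete : ∀ {l} → CoreAdj l₀ l ≡ true → layer l ≡ ℓ → ∃ λ i → l ≡ a i
      injective : ∀ {i j} → a i ≡ a j → i ≡ j

  exactlyOne-neighbour : ∀ {s} → IsCopyK d Γ s → ∀ {g t l₀ ℓ m} {a : Fin m → Loc} →
    IsFill l₀ ≡ false → LayerNeighbours l₀ ℓ a →
    pos (g , t , l₀) ∈ s → ∃! _≡_ (λ i → pos (g , t , a i) ∈ s)
  exactlyOne-neighbour {s} s-copy {g} {t} {l₀} {ℓ} {a = a} l₀-core nbrs l₀∈s
    with InCopy.partner s-copy {g} {t} {l₀} l₀-core l₀∈s ℓ (LayerNeighbours.layer≢ nbrs)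
  ... | l , l∈s , adj , layer≡ℓ with LayerNeighbours.complete nbrs adj layer≡ℓ
  ...   | i , refl = i , l∈s , unique
    where
    open LayerNeighbours nbrs
    layer-at : ∀ j → layer (location (pos (g , t , a j))) ≡ ℓ
    layer-at j = trans (cong (layer ∘ proj₂ ∘ proj₂) (decode-encode vertexCode (g , t , a j))) (in-layer j)
    unique : ∀ {j} → pos (g , t , a j) ∈ s → i ≡ j
    unique {j} aⱼ∈s = injective (cong (proj₂ ∘ proj₂) (encode-injective vertexCode {g , t , a i} {g , t , a j}
      (InCopy.layer-injective s-copy {g} {t} {l₀} l₀-core l₀∈s l∈s aⱼ∈s (trans (layer-at i) (sym (layer-at j))))))

  nonadjacent : ∀ {s} → IsCopyK d Γ s → ∀ {g t l l'} → l ≢ l' → CoreAdj l l' ≡ false → IsFill l ≡ false →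
    pos (g , t , l) ∈ s → pos (g , t , l') ∈ s → ⊥
  nonadjacent s-copy {g} {t} {l} {l'} l≢l' notCore notFill l∈s l'∈s
    with Adj-sameSlot {g} {t} (subst₂ (λ u v → Adj u v ≡ true)
           (decode-encode vertexCode (g , t , l)) (decode-encode vertexCode (g , t , l'))
           (proj₂ s-copy _ _ l∈s l'∈s
             (l≢l' ∘ cong (proj₂ ∘ proj₂) ∘ encode-injective vertexCode {g , t , l} {g , t , l'})))
  ... | inj₁ core = true≢false (trans (sym core) notCore)
  ... | inj₂ (fill , _) = true≢false (trans (sym fill) notFill)

  pair : Loc → Loc → Fin 2 → Loc
  pair l _ 0F = l
  pair _ l' 1F = l'

  pair-injective : ∀ {l l'} → l ≢ l' → ∀ {i j} → pair l l' i ≡ pair l l' j → i ≡ j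
  pair-injective _ {0F} {0F} _ = refl
  pair-injective _ {1F} {1F} _ = refl
  pair-injective l≢l' {0F} {1F} eq = ⊥-elim (l≢l' eq)
  pair-injective l≢l' {1F} {0F} eq = ⊥-elim (l≢l' (sym eq))

  pair-in-layer : ∀ {l l' ℓ} → layer l ≡ ℓ → layer l' ≡ ℓ → ∀ i → layer (pair l l' i) ≡ ℓ
  pair-in-layer eq _ 0F = eq
  pair-in-layer _ eq' 1F = eq'

  neighbours-x₀ : ∀ i → LayerNeighbours (x₀ i) 1F (pair (y₀ i) (y₁ i))
  neighbours-x₀ i = record
    { layer≢ = λ () ; in-layer = pair-in-layer refl refl ; complete = complete ; injective = pair-injective (λ ()) }
    where
    complete : ∀ {l} → CoreAdj (x₀ i) l ≡ true → layer l ≡ 1F → ∃ λ j → l ≡ pair (y₀ i) (y₁ i) j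
    complete {y₀ i'} adj _ = 0F , cong y₀ (sym (==⇒≡ (∨-false⁻ adj)))
    complete {y₁ i'} adj _ = 1F , cong y₁ (sym (==⇒≡ (∨-false⁻ adj)))
    complete {apex _ _} _ ()
    complete {x₀ _} _ ()
    complete {x₁ _} _ ()
    complete {spare _} _ ()

  neighbours-x₁ : ∀ i → LayerNeighbours (x₁ i) 1F (pair (y₁ (inject₁ i)) (y₀ (suc i)))
  neighbours-x₁ i = record
    { layer≢ = λ () ; in-layer = pair-in-layer refl refl ; complete = complete ; injective = pair-injective (λ ()) }
    where
    complete : ∀ {l} → CoreAdj (x₁ i) l ≡ true → layer l ≡ 1F → ∃ λ j → l ≡ pair (y₁ (inject₁ i)) (y₀ (suc i)) j
    complete {y₁ u} adj _ = 0F , cong y₁ (sym (==⇒≡ (∨-false⁻ adj)))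
    complete {y₀ u} adj _ = 1F , cong y₀ (sym (==⇒≡ (∨-false⁻ adj)))
    complete {apex _ _} _ ()
    complete {x₀ _} _ ()
    complete {x₁ _} _ ()
    complete {spare _} _ ()

  neighbours-y₁ : ∀ i → LayerNeighbours (y₁ (inject₁ i)) 0F (pair (x₀ (inject₁ i)) (x₁ i))
  neighbours-y₁ i = record
    { layer≢ = λ () ; in-layer = pair-in-layer refl refl ; complete = complete ; injective = pair-injective (λ ()) }
    where
    complete : ∀ {l} → CoreAdj (y₁ (inject₁ i)) l ≡ true → layer l ≡ 0F → ∃ λ j → l ≡ pair (x₀ (inject₁ i)) (x₁ i) j
    complete {x₀ i'} adj _ = 0F , cong x₀ (==⇒≡ adj)
    complete {x₁ i'} adj _ = 1F , cong x₁ (Finₚ.inject₁-injective (==⇒≡ adj))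
    complete {apex _ _} _ ()
    complete {y₀ _} _ ()
    complete {y₁ _} _ ()
    complete {spare _} ()

  neighbours-y₀ : ∀ i → LayerNeighbours (y₀ (suc i)) 0F (pair (x₁ i) (x₀ (suc i)))
  neighbours-y₀ i = record
    { layer≢ = λ () ; in-layer = pair-in-layer refl refl ; complete = complete ; injective = pair-injective (λ ()) }
    where
    complete : ∀ {l} → CoreAdj (y₀ (suc i)) l ≡ true → layer l ≡ 0F → ∃ λ j → l ≡ pair (x₁ i) (x₀ (suc i)) j
    complete {x₁ i'} adj _ = 0F , cong x₁ (Finₚ.suc-injective (==⇒≡ adj))
    complete {x₀ i'} adj _ = 1F , cong x₀ (==⇒≡ adj)
    complete {apex _ _} _ ()
    complete {y₀ _} _ ()
    complete {y₁ _} _ ()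
    complete {spare _} ()

  neighbours-portal : LayerNeighbours (y₁ (fromℕ c')) 0F {1} (λ _ → x₀ (fromℕ c'))
  neighbours-portal = record
    { layer≢ = λ () ; in-layer = λ _ → refl ; complete = complete ; injective = λ { {0F} {0F} _ → refl } }
    where
    complete : ∀ {l} → CoreAdj (y₁ (fromℕ c')) l ≡ true → layer l ≡ 0F → ∃ λ (j : Fin 1) → l ≡ x₀ (fromℕ c')
    complete {x₀ i'} adj _ = 0F , cong x₀ (==⇒≡ adj)
    complete {x₁ i'} adj _ = ⊥-elim (Finₚ.fromℕ≢inject₁ (sym (==⇒≡ {x = inject₁ i'} adj)))
    complete {apex _ _} _ ()
    complete {y₀ _} _ ()
    complete {y₁ _} _ ()
    complete {spare _} ()

  hub₀ : Loc
  hub₀ = apex hub 0F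

  neighbours-hub : LayerNeighbours hub₀ 0F x₀
  neighbours-hub = record
    { layer≢ = λ () ; in-layer = λ _ → refl ; complete = complete ; injective = λ { refl → refl } }
    where
    complete : ∀ {l} → CoreAdj hub₀ l ≡ true → layer l ≡ 0F → ∃ λ i → l ≡ x₀ i
    complete {x₀ i} _ _ = i , refl
    complete {apex _ _} _ ()
    complete {x₁ _} ()
    complete {y₀ _} _ ()
    complete {y₁ _} _ ()
    complete {spare _} ()

  hubOrWing : Fin (suc c') → Loc
  hubOrWing 0F = hub₀
  hubOrWing (suc j) = apex (wing j) 0F

  upperNeighbours-x₀ : ∀ i → LayerNeighbours (x₀ i) 2F hubOrWing
  upperNeighbours-x₀ i = record
    { layer≢ = λ () ; in-layer = λ { 0F → refl ; (suc _) → refl } ; complete = complete ; injective = injective }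
    where
    complete : ∀ {l} → CoreAdj (x₀ i) l ≡ true → layer l ≡ 2F → ∃ λ j → l ≡ hubOrWing j
    complete {apex hub 0F} _ _ = 0F , refl
    complete {apex (wing j) 0F} _ _ = suc j , refl
    complete {apex (bridge _) 0F} ()
    complete {x₀ _} _ ()
    complete {x₁ _} _ ()
    complete {y₀ _} _ ()
    complete {y₁ _} _ ()
    complete {spare _} _ ()
    injective : ∀ {j j'} → hubOrWing j ≡ hubOrWing j' → j ≡ j'
    injective {0F} {0F} _ = refl
    injective {suc _} {suc _} refl = refl

  module Slot {P} (copies : All (IsCopyK d Γ) P) (g : Fin k) (t : Fin d) where

    at : Loc → Fin n
    at l = pos (g , t , l)

    cover-via : ∀ {l₀ ℓ m} {a : Fin m → Loc} → IsFill l₀ ≡ false → LayerNeighbours l₀ ℓ a →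
      cover (at l₀) P ≡ ∑[ i < m ] cover₂ (at l₀) (at (a i)) P
    cover-via {l₀} {a = a} l₀-core nbrs =
      cover-split (at l₀) (at ∘ a) copies (λ s-copy → exactlyOne-neighbour s-copy {g} {t} l₀-core nbrs)

    cover-via₂ : ∀ {l₀ ℓ l l'} → IsFill l₀ ≡ false → LayerNeighbours l₀ ℓ (pair l l') →
      cover (at l₀) P ≡ cover₂ (at l₀) (at l) P + cover₂ (at l₀) (at l') P
    cover-via₂ {l₀} {l = l} {l'} l₀-core nbrs =
      trans (cover-via l₀-core nbrs) (cong (cover₂ (at l₀) (at l) P +_) (+-identityʳ (cover₂ (at l₀) (at l') P)))

    hub-link : ∀ i → cover₂ (at hub₀) (at (x₀ i)) P ≡ cover₂ (at (x₀ i)) (at (y₀ i)) P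
    hub-link i = cover₂-transfer _ _ _ copies onward backward
      where
      onward : ∀ {s} → IsCopyK d Γ s → at hub₀ ∈ s → at (x₀ i) ∈ s → at (y₀ i) ∈ s
      onward s-copy hub∈s x∈s with exactlyOne-neighbour s-copy {g} {t} refl (neighbours-x₀ i) x∈s
      ... | 0F , y₀∈s , _ = y₀∈s
      ... | 1F , y₁∈s , _ = ⊥-elim (nonadjacent s-copy {g} {t} {hub₀} {y₁ i} (λ ()) refl refl hub∈s y₁∈s)
      backward : ∀ {s} → IsCopyK d Γ s → at (x₀ i) ∈ s → at (y₀ i) ∈ s → at hub₀ ∈ s
      backward s-copy x∈s y∈s with exactlyOne-neighbour s-copy {g} {t} refl (upperNeighbours-x₀ i) x∈s
      ... | 0F , hub∈s , _ = hub∈s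
      ... | suc j , wing∈s , _ =
        ⊥-elim (nonadjacent s-copy {g} {t} {apex (wing j) 0F} {y₀ i} (λ ()) refl refl wing∈s y∈s)

    portal-forced : (∀ l → l ≢ y₁ (fromℕ c') → cover (at l) P ≡ c) → cover (at (y₁ (fromℕ c'))) P ≡ c'
    portal-forced internal = begin
      cover (at (y₁ (fromℕ c'))) P                                 ≡⟨ cover-via refl neighbours-portal ⟩
      cover₂ (at (y₁ (fromℕ c'))) (at (x₀ (fromℕ c'))) P + 0      ≡⟨ +-identityʳ _ ⟩
      cover₂ (at (y₁ (fromℕ c'))) (at (x₀ (fromℕ c'))) P          ≡⟨ cover₂-sym _ _ P ⟩
      W (fromℕ c')                                                ≡⟨ alternating-path-count c' A W B Y A+W W+B B+Y Y+A ∑A ⟩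
      c'                                                          ∎
      where
      open ≡-Reasoning
      A W : Fin c → ℕ
      A i = cover₂ (at (x₀ i)) (at (y₀ i)) P
      W i = cover₂ (at (x₀ i)) (at (y₁ i)) P
      B Y : Fin c' → ℕ
      B i = cover₂ (at (y₁ (inject₁ i))) (at (x₁ i)) P
      Y i = cover₂ (at (x₁ i)) (at (y₀ (suc i))) P
      A+W : ∀ i → A i + W i ≡ c
      A+W i = trans (sym (cover-via₂ refl (neighbours-x₀ i))) (internal (x₀ i) (λ ()))
      W+B : ∀ i → W (inject₁ i) + B i ≡ c
      W+B i = trans (cong (_+ B i) (cover₂-sym _ _ P)) (trans (sym (cover-via₂ refl (neighbours-y₁ i)))
        (internal (y₁ (inject₁ i)) (λ eq → Finₚ.fromℕ≢inject₁ (sym (y₁-injective eq)))))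
        where y₁-injective : ∀ {u u'} → _≡_ {A = Loc} (y₁ u) (y₁ u') → u ≡ u'
              y₁-injective refl = refl
      B+Y : ∀ i → B i + Y i ≡ c
      B+Y i = trans (cong (_+ Y i) (cover₂-sym _ _ P)) (trans (sym (cover-via₂ refl (neighbours-x₁ i)))
        (internal (x₁ i) (λ ())))
      Y+A : ∀ i → Y i + A (suc i) ≡ c
      Y+A i = trans (cong₂ _+_ (cover₂-sym _ _ P) (cover₂-sym _ _ P))
        (trans (sym (cover-via₂ refl (neighbours-y₀ i))) (internal (y₀ (suc i)) (λ ())))
      ∑A : sum A ≡ c
      ∑A = trans (sum-cong-≗ (sym ∘ hub-link)) (trans (sym (cover-via refl neighbours-hub)) (internal hub₀ (λ ())))

  internal : ∀ g t l → l ≢ y₁ (fromℕ c') → Internal G (pos (g , t , l))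
  internal g t l l≢portal (i , portal≡) =
    l≢portal (sym (cong (proj₂ ∘ proj₂) (encode-injective vertexCode {portalVertex i} {g , t , l} portal≡)))

  portal-or-internal : ∀ v →
    (∃ λ i → portal G i ≡ v) ⊎ (∃ λ ((g , t , l) : Vertex) → l ≢ y₁ (fromℕ c') × pos (g , t , l) ≡ v)
  portal-or-internal v with vtx v in vtx≡
  ... | g , t , l with ≟El locCode l (y₁ (fromℕ c'))
  ...   | no l≢portal = inj₂ ((g , t , l) , l≢portal , trans (cong pos (sym vtx≡)) (encode-decode vertexCode v))
  ...   | yes refl = inj₁ (combine g t , trans
          (cong (λ (g , t) → pos (g , t , y₁ (fromℕ c'))) (Finₚ.remQuot-combine g t))
          (trans (cong pos (sym vtx≡)) (encode-decode vertexCode v)))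

  canonical-packing : IsMultiPacking c d Γ canonical
  canonical-packing = canonical-copies , bounded
    where
    bounded : ∀ v → cover v canonical ≤ c
    bounded v with portal-or-internal v
    ... | inj₁ (i , refl) =
      ≤-trans (≤-reflexive (cover-canonical-portal (proj₁ (remQuot {k} d i)) (proj₂ (remQuot {k} d i)))) (n≤1+n c')
    ... | inj₂ ((g , t , l) , l≢portal , refl) = ≤-reflexive (cover-canonical-internal g t l l≢portal)

  canonical-covers : ∀ (r : Fin (k * d) → Fin (suc c)) → Constant c' r → CoversAs c G (toℕs r) canonical
  canonical-covers r r≡c' = covers-internal , λ i →
    trans (cover-canonical-portal (proj₁ (remQuot {k} d i)) (proj₂ (remQuot {k} d i))) (sym (r≡c' i))
    where
    covers-internal : ∀ v → Internal G v → cover v canonical ≡ c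
    covers-internal v v-internal with portal-or-internal v
    ... | inj₁ portal≡v = ⊥-elim (v-internal portal≡v)
    ... | inj₂ ((g , t , l) , l≢portal , refl) = cover-canonical-internal g t l l≢portal

  realized⇒constant : ∀ (r : Fin (k * d) → Fin (suc c)) P →
    IsMultiPacking c d Γ P → CoversAs c G (toℕs r) P → Constant c' r
  realized⇒constant r P (copies , _) (covers-internal , covers-portal) i = trans (sym (covers-portal i))
    (Slot.portal-forced copies g t (λ l l≢portal → covers-internal _ (internal g t l l≢portal)))
    where
    g : Fin k
    g = proj₁ (remQuot {k} d i)
    t : Fin d
    t = proj₂ (remQuot {k} d i)

  G-strictlyRealizes : StrictlyRealizes c d G (Constant c')
  G-strictlyRealizes =
    (λ r → record
      { to = λ r≡c' → canonical , (canonical-packing , canonical-unique) , canonical-covers r r≡c'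
      ; from = λ (P , (packing , _) , covers) → realized⇒constant r P packing covers
      }) ,
    (λ r → record
      { to = λ r≡c' → canonical , canonical-packing , canonical-covers r r≡c'
      ; from = λ (P , packing , covers) → realized⇒constant r P packing covers
      })

mainTheorem14 : (c d : ℕ) → 2 ≤ c → 3 ≤ d →
    ∃ λ (f : ℕ → ℕ) → (k : ℕ) → 1 ≤ k →
      Σ (Gadget (k * d)) λ G →
        StrictlyRealizes c d G (Constant (c ∸ 1)) × size G ≤ f k
mainTheorem14 (suc c') (suc (suc (suc e'))) (s≤s _) (s≤s (s≤s (s≤s _))) =
  -- The construction only needs c ≥ 1.
  Construction.n c' e' , λ k _ → Construction.G c' e' k , Construction.G-strictlyRealizes c' e' k , ≤-refl
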